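{- Assume that every finite simple graph $G$ satisfies $q_{list}(G)\le \Delta(G)+1$, where $\Delta(G)$ is the maximum degree of $G$. Let $H=(V,E)$ be a finite linear hypergraph with $n$ vertices. Let $H_3=(V,E_3)$ where $E_3$ is the set of edges of $H$ of rank at least $3$, and let $H_2=(V,E_2)$ where $E_2$ is the set of edges of $H$ of rank exactly $2$. Let $\Delta$ be the maximum degree of $H_3$, and suppose the maximum degree of the graph $H_2$ is at most $n-2\Delta-1$. Then every edge coloring of $H_3$ with colors from a set of $n$ colors can be extended to an edge coloring of $H$ using colors from the same set of $n$ colors.
   Context: A hypergraph $H=(V,E)$ is a finite set $V$ with a set $E$ of subsets of $V$ (edges); the rank of an edge is its cardinality, the degree of a vertex is the number of edges containing it, and $H$ is linear if any two distinct edges share at most one vertex. An edge coloring is a map $\gamma$ from the edges to a set of colors such that $\gamma(e)=\gamma(f)$ for distinct edges $e,f$ only if $e\cap f=\emptyset$. For a graph $G$, $q_{list}(G)$ is the least $k$ such that for every assignment of a list of $k$ colors to each edge of $G$, there is a proper edge coloring of $G$ (adjacent edges receive different colors) in which each edge gets a color from its own list. -}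

module Defs where

open import Data.Nat using (ℕ; _≤_; _+_; _*_; _⊔_; _≟_; _≤?_)
open import Data.Fin using (Fin)
open import Data.Fin.Subset using (Subset; _∈_; _∩_; ∣_∣)
open import Data.Fin.Subset.Properties using (_∈?_)
open import Data.List using (List; length; filter; map; foldr; allFin)
open import Data.List.Relation.Unary.Unique.Propositional using (Unique)
import Data.List.Membership.Propositional as LM
open import Data.Product using (Σ; Σ-syntax; _×_; ∃-syntax)
open import Data.Empty using (⊥)
open import Relation.Nullary using (¬_)
open import Relation.Nullary.Decidable using (_×-dec_)
open import Relation.Binary.PropositionalEquality using (_≡_; _≢_)
open import Function.Definitions using (Injective)

-- A finite hypergraph on vertex set Fin n with m edges; E is a SET of
-- subsets of V, so the edge map is injective (no repeated edges).
record Hypergraph (n m : ℕ) : Set where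
  field
    edge     : Fin m → Subset n
    edge-inj : Injective _≡_ _≡_ edge
open Hypergraph public

module _ {n m : ℕ} (H : Hypergraph n m) where

  rank : Fin m → ℕ
  rank e = ∣ edge H e ∣

  Linear : Set
  Linear = ∀ e f → e ≢ f → ∣ edge H e ∩ edge H f ∣ ≤ 1

  Disjoint : Fin m → Fin m → Set
  Disjoint e f = ∀ v → v ∈ edge H e → v ∈ edge H f → ⊥

  IsEdgeColoring : {A : Set} → (Fin m → A) → Set
  IsEdgeColoring c = ∀ e f → e ≢ f → c e ≡ c f → Disjoint e f

  IsEdgeColoring₃ : {A : Set} → ((e : Fin m) → 3 ≤ rank e → A) → Set
  IsEdgeColoring₃ c = ∀ e f (p : 3 ≤ rank e) (q : 3 ≤ rank f) →
                      e ≢ f → c e p ≡ c f q → Disjoint e f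

  degree : Fin n → ℕ
  degree v = length (filter (λ e → v ∈? edge H e) (allFin m))

  degree₃ : Fin n → ℕ
  degree₃ v = length (filter (λ e → (3 ≤? rank e) ×-dec (v ∈? edge H e)) (allFin m))

  degree₂ : Fin n → ℕ
  degree₂ v = length (filter (λ e → (rank e ≟ 2) ×-dec (v ∈? edge H e)) (allFin m))

  maxOver : (Fin n → ℕ) → ℕ
  maxOver d = foldr _⊔_ 0 (map d (allFin n))

  -- maximum degrees (0 if there are no vertices)
  maxDegree maxDegree₃ maxDegree₂ : ℕ
  maxDegree  = maxOver degree
  maxDegree₃ = maxOver degree₃
  maxDegree₂ = maxOver degree₂

  IsSimpleGraph : Set
  IsSimpleGraph = ∀ e → rank e ≡ 2

  EdgeChoosable : ℕ → Set
  EdgeChoosable k =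
    (L : Fin m → List ℕ) → (∀ e → length (L e) ≡ k) → (∀ e → Unique (L e)) →
    Σ[ c ∈ (Fin m → ℕ) ] ((∀ e → c e LM.∈ L e) × IsEdgeColoring c)

-- "q_list(G) ≤ Δ(G) + 1": the least k with G k-edge-choosable is ≤ Δ+1,
-- i.e. some k ≤ Δ+1 has G k-edge-choosable.
ListColoringHypothesis : Set
ListColoringHypothesis =
  ∀ (k m : ℕ) (G : Hypergraph k m) → IsSimpleGraph G →
  ∃[ q ] (q ≤ maxDegree G + 1 × EdgeChoosable G q)

-- The list-colouring hypothesis is applied to an auxiliary simple graph: the rank-2 edges of H,
-- together with a private pair of new vertices for every other edge, so that its maximum degree is
-- at most max(Δ₂, 1).  Each rank-2 edge e receives the list of the first q ≤ Δ₂ + 1 colours not used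
-- on the at most 2Δ₃ edges of rank ≥ 3 that meet e; the bound Δ₂ + 2Δ₃ + 1 ≤ n is exactly what
-- makes these lists long enough, and a list colouring then extends the colouring of H₃ to the edges
-- of rank ≥ 2.  A rank-1 edge {w} meets at most Δ₂ + Δ₃ < n edges of rank ≥ 2, so it gets a free
-- colour; two distinct rank-1 edges, and an edge of rank 0 and any edge, are always disjoint.
module Submission where

open import Defs
open import Data.Nat using (ℕ; suc; _≤_; _<_; _+_; _*_; _⊔_; z≤n; s≤s; _≤?_; _≟_)
open import Data.Nat.Properties
open import Data.Fin using (Fin; toℕ; fromℕ<; _↑ˡ_; _↑ʳ_; splitAt) renaming (zero to fzero; suc to fsuc)
import Data.Fin.Properties as Fin
open import Data.Fin.Subset using (Subset; _∈_; ∣_∣; inside; outside; ⊥; ⁅_⁆; _∩_; Nonempty)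
open import Data.Fin.Subset.Properties
  using (_∈?_; nonempty?; ∉⊥; ∣⊥∣≡0; x∈⁅x⁆; x∈⁅y⁆⇒x≡y; ∣⁅x⁆∣≡1; x∈p∩q⁺; x∈p∩q⁻; ⊆-antisym;
         x∈p⇒∣p-x∣<∣p∣; x∈p∧x≢y⇒x∈p-y)
open import Data.Vec using ([]; _∷_; here; there) renaming (_++_ to _++ᵥ_)
open import Data.Vec.Properties using (++-injectiveˡ; ++-injectiveʳ; lookup-++ˡ; lookup-++ʳ; []=⇒lookup; lookup⇒[]=)
open import Data.List using (List; []; _∷_; length; filter; map; allFin; take; upTo)
open import Data.List.Properties
  using (filter-none; filter-some; length-map; length-take; length-tabulate; length-upTo; foldr-forcesᵇ; foldr-preservesᵇ)
open import Data.List.Relation.Unary.All as All using (All)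
open import Data.List.Relation.Unary.All.Properties using () renaming (map⁺ to All-map⁺; take⁺ to All-take⁺)
open import Data.List.Relation.Unary.Any using (here; there)
open import Data.List.Relation.Unary.AllPairs using (_∷_)
open import Data.List.Relation.Unary.Unique.Propositional using (Unique)
import Data.List.Relation.Unary.Unique.Propositional.Properties as Unique
open import Data.List.Relation.Binary.Sublist.Propositional using (_⊆_; _∷ʳ_; ⊆-refl)
open import Data.List.Relation.Binary.Sublist.Propositional.Properties
  using (length-mono-≤) renaming (filter⁺ to filter-⊆⁺)
open import Data.List.Membership.Propositional using (lose) renaming (_∈_ to _∈ₗ_; _∉_ to _∉ₗ_)
import Data.List.Membership.DecPropositional as DecMembership
open import Data.List.Membership.Propositional.Properties using (∈-filter⁺; ∈-filter⁻; ∈-map⁺; ∈-map⁻; ∈-allFin)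
open import Data.Product using (Σ-syntax; ∃-syntax; ∃₂; _×_; _,_; proj₁; proj₂)
open import Data.Sum using (_⊎_; inj₁; inj₂)
import Data.Sum as Sum
open import Function using (_∘_)
open import Relation.Nullary using (Dec; yes; no; contradiction)
open import Relation.Nullary.Decidable using (_×-dec_)
open import Relation.Unary using (Pred; Decidable; _∪_)
open import Relation.Unary.Properties using (∁?)
open import Relation.Binary.Definitions using (DecidableEquality)
open import Relation.Binary.PropositionalEquality
  using (_≡_; _≢_; refl; sym; trans; cong; cong₂; subst; module ≡-Reasoning)

module _ {a} {A : Set a} where

  count : ∀ {p} {P : Pred A p} → Decidable P → List A → ℕ
  count P? xs = length (filter P? xs)

  module _ {p q} {P : Pred A p} {Q : Pred A q} (P? : Decidable P) (Q? : Decidable Q) where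

    count-mono : (∀ {x} → P x → Q x) → ∀ {xs ys} → xs ⊆ ys → count P? xs ≤ count Q? ys
    count-mono P⊆Q xs⊆ys = length-mono-≤ (filter-⊆⁺ P? Q? (λ { refl → P⊆Q }) xs⊆ys)

  module _ {p} {P : Pred A p} (P? : Decidable P) where

    count-≤-∷ : ∀ x xs → count P? xs ≤ count P? (x ∷ xs)
    count-≤-∷ x xs = count-mono P? P? (λ Px → Px) (x ∷ʳ ⊆-refl)

    count-+-count-∁ : ∀ xs → count P? xs + count (∁? P?) xs ≡ length xs
    count-+-count-∁ [] = refl
    count-+-count-∁ (x ∷ xs) with P? x
    ... | yes _ = cong suc (count-+-count-∁ xs)
    ... | no _ = trans (+-suc _ _) (cong suc (count-+-count-∁ xs))

    count-≤-1 : ∀ {xs} → Unique xs → (∀ {x y} → P x → P y → x ≡ y) → count P? xs ≤ 1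
    count-≤-1 {[]} _ _ = z≤n
    count-≤-1 {x ∷ xs} (x∉xs ∷ xs-unique) P-unique with P? x
    ... | yes Px = s≤s (≤-reflexive (cong length (filter-none P?
                     (All.map (λ x≢y Py → x≢y (P-unique Px Py)) x∉xs))))
    ... | no _ = count-≤-1 xs-unique P-unique

  module _ {p q r} {P : Pred A p} {Q : Pred A q} {R : Pred A r}
           (P? : Decidable P) (Q? : Decidable Q) (R? : Decidable R) where

    count-≤-+ : (∀ {x} → P x → Q x ⊎ R x) → ∀ xs → count P? xs ≤ count Q? xs + count R? xs
    count-≤-+ P⊆Q∪R [] = z≤n
    count-≤-+ P⊆Q∪R (x ∷ xs) with ih ← count-≤-+ P⊆Q∪R xs | P? x
    ... | no _ = ≤-trans ih (+-mono-≤ (count-≤-∷ Q? x xs) (count-≤-∷ R? x xs))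
    ... | yes Px with Q? x
    ...   | yes _ = s≤s (≤-trans ih (+-monoʳ-≤ (count Q? xs) (count-≤-∷ R? x xs)))
    ...   | no ¬Q with R? x
    ...     | yes _ = ≤-trans (s≤s ih) (≤-reflexive (sym (+-suc _ _)))
    ...     | no ¬R = Sum.[ (λ Qx → contradiction Qx ¬Q) , (λ Rx → contradiction Rx ¬R) ] (P⊆Q∪R Px)

  module _ (_≟ᴬ_ : DecidableEquality A) where
    open DecMembership _≟ᴬ_ using () renaming (_∈?_ to _∈ₗ?_)

    count-∈-≤-length : ∀ {xs} → Unique xs → (B : List A) → count (_∈ₗ? B) xs ≤ length B
    count-∈-≤-length {xs} _ [] = ≤-reflexive (cong length (filter-none (_∈ₗ? []) (All.universal (λ _ ()) xs)))
    count-∈-≤-length {xs} xs-unique (b ∷ B) = begin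
      count (_∈ₗ? b ∷ B) xs               ≤⟨ count-≤-+ (_∈ₗ? b ∷ B) (_≟ᴬ b) (_∈ₗ? B) ∈-∷⁻ xs ⟩
      count (_≟ᴬ b) xs + count (_∈ₗ? B) xs ≤⟨ +-mono-≤ (count-≤-1 (_≟ᴬ b) xs-unique (λ x≡b y≡b → trans x≡b (sym y≡b)))
                                                       (count-∈-≤-length xs-unique B) ⟩
      1 + length B                         ∎
      where
      open ≤-Reasoning
      ∈-∷⁻ : ∀ {x} → x ∈ₗ b ∷ B → x ≡ b ⊎ x ∈ₗ B
      ∈-∷⁻ (here x≡b) = inj₁ x≡b
      ∈-∷⁻ (there x∈B) = inj₂ x∈B

module _ {n : ℕ} where
  open DecMembership (Fin._≟_ {n}) using () renaming (_∈?_ to _∈ₗ?_)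

  available : List (Fin n) → List (Fin n)
  available B = filter (∁? (_∈ₗ? B)) (allFin n)

  available-∉ : ∀ {B x} → x ∈ₗ available B → x ∉ₗ B
  available-∉ {B} x∈ = proj₂ (∈-filter⁻ (∁? (_∈ₗ? B)) {xs = allFin n} x∈)

  available-unique : ∀ B → Unique (available B)
  available-unique B = Unique.filter⁺ (∁? (_∈ₗ? B)) (Unique.allFin⁺ n)

  length-available : ∀ {k} B → k + length B ≤ n → k ≤ length (available B)
  length-available {k} B k+B≤n = +-cancelʳ-≤ (length B) k (length (available B)) (begin
    k + length B                                      ≤⟨ k+B≤n ⟩
    n                                                 ≡⟨ sym (length-tabulate {n = n} (λ x → x)) ⟩
    length (allFin n)                                 ≡⟨ sym (count-+-count-∁ (_∈ₗ? B) (allFin n)) ⟩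
    count (_∈ₗ? B) (allFin n) + length (available B)  ≤⟨ +-monoˡ-≤ _ (count-∈-≤-length Fin._≟_ (Unique.allFin⁺ n) B) ⟩
    length B + length (available B)                   ≡⟨ +-comm (length B) _ ⟩
    length (available B) + length B                   ∎)
    where open ≤-Reasoning

  fresh : (B : List (Fin n)) → length B < n → ∃[ x ] x ∉ₗ B
  fresh B B<n with available B in eq | length-available B B<n
  ... | [] | ()
  ... | x ∷ _ | _ = x , available-∉ (subst (x ∈ₗ_) (sym eq) (here refl))

module _ {n m : ℕ} (H : Hypergraph n m) where

  ≤-maxOver : ∀ d v → d v ≤ maxOver H d
  ≤-maxOver d v =
    All.lookup (foldr-forcesᵇ ⊔-≤⁻ 0 (map d (allFin n)) ≤-refl) (∈-map⁺ d (∈-allFin v))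
    where
    ⊔-≤⁻ : ∀ x y → x ⊔ y ≤ maxOver H d → x ≤ maxOver H d × y ≤ maxOver H d
    ⊔-≤⁻ x y x⊔y≤ = m⊔n≤o⇒m≤o x y x⊔y≤ , m⊔n≤o⇒n≤o x y x⊔y≤

  maxOver-≤ : ∀ d {b} → (∀ v → d v ≤ b) → maxOver H d ≤ b
  maxOver-≤ d {b} d≤b = foldr-preservesᵇ {P = _≤ b} ⊔-lub z≤n (All-map⁺ (All.universal d≤b (allFin n)))

x∈p⇒0<∣p∣ : ∀ {n x} {p : Subset n} → x ∈ p → 0 < ∣ p ∣
x∈p⇒0<∣p∣ x∈p = ≤-trans (s≤s z≤n) (x∈p⇒∣p-x∣<∣p∣ x∈p)

∣p∣≡1⇒p≡⁅x⁆ : ∀ {n x} {p : Subset n} → ∣ p ∣ ≡ 1 → x ∈ p → p ≡ ⁅ x ⁆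
∣p∣≡1⇒p≡⁅x⁆ {x = x} {p} ∣p∣≡1 x∈p = ⊆-antisym (λ y∈p → subst (_∈ ⁅ x ⁆) (sym (≡x y∈p)) (x∈⁅x⁆ x))
                                                (λ y∈⁅x⁆ → subst (_∈ p) (sym (x∈⁅y⁆⇒x≡y x y∈⁅x⁆)) x∈p)
  where
  -- a second element y would survive in p - x, making ∣ p ∣ at least 2
  ≡x : ∀ {y} → y ∈ p → y ≡ x
  ≡x {y} y∈p with y Fin.≟ x
  ... | yes y≡x = y≡x
  ... | no y≢x = contradiction (subst (2 ≤_) ∣p∣≡1 2≤∣p∣) (λ { (s≤s ()) })
    where
    2≤∣p∣ : 2 ≤ ∣ p ∣
    2≤∣p∣ = ≤-trans (s≤s (x∈p⇒0<∣p∣ (x∈p∧x≢y⇒x∈p-y y∈p y≢x))) (x∈p⇒∣p-x∣<∣p∣ x∈p)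

∣p∣≡suc⇒nonempty : ∀ {n k} {p : Subset n} → ∣ p ∣ ≡ suc k → Nonempty p
∣p∣≡suc⇒nonempty {p = inside ∷ p} _ = fzero , here
∣p∣≡suc⇒nonempty {p = outside ∷ p} eq = let (x , x∈p) = ∣p∣≡suc⇒nonempty eq in fsuc x , there x∈p

∣p∣≡2⇒⊆pair : ∀ {n} {p : Subset n} → ∣ p ∣ ≡ 2 → ∃₂ λ u v → ∀ {x} → x ∈ p → x ≡ u ⊎ x ≡ v
∣p∣≡2⇒⊆pair {p = inside ∷ p} eq =
  let (v , v∈p) = ∣p∣≡suc⇒nonempty (suc-injective eq)
      p≡⁅v⁆ = ∣p∣≡1⇒p≡⁅x⁆ (suc-injective eq) v∈p
  in fzero , fsuc v , λ { here → inj₁ refl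
                         ; (there x∈p) → inj₂ (cong fsuc (x∈⁅y⁆⇒x≡y v (subst (_ ∈_) p≡⁅v⁆ x∈p))) }
∣p∣≡2⇒⊆pair {p = outside ∷ p} eq =
  let (u , v , ⊆uv) = ∣p∣≡2⇒⊆pair eq
  in fsuc u , fsuc v , λ { (there x∈p) → Sum.map (cong fsuc) (cong fsuc) (⊆uv x∈p) }

∣p++q∣≡∣p∣+∣q∣ : ∀ {a b} (p : Subset a) (q : Subset b) → ∣ p ++ᵥ q ∣ ≡ ∣ p ∣ + ∣ q ∣
∣p++q∣≡∣p∣+∣q∣ [] q = refl
∣p++q∣≡∣p∣+∣q∣ (inside ∷ p) q = cong suc (∣p++q∣≡∣p∣+∣q∣ p q)
∣p++q∣≡∣p∣+∣q∣ (outside ∷ p) q = ∣p++q∣≡∣p∣+∣q∣ p q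

module _ {a b : ℕ} {p : Subset a} {q : Subset b} where

  ↑ˡ-∈-++⁺ : ∀ {x} → x ∈ p → (x ↑ˡ b) ∈ p ++ᵥ q
  ↑ˡ-∈-++⁺ x∈p = lookup⇒[]= _ (p ++ᵥ q) (trans (lookup-++ˡ p q _) ([]=⇒lookup x∈p))

  ↑ˡ-∈-++⁻ : ∀ {x} → (x ↑ˡ b) ∈ p ++ᵥ q → x ∈ p
  ↑ˡ-∈-++⁻ x∈p++q = lookup⇒[]= _ p (trans (sym (lookup-++ˡ p q _)) ([]=⇒lookup x∈p++q))

  ↑ʳ-∈-++⁻ : ∀ {y} → (a ↑ʳ y) ∈ p ++ᵥ q → y ∈ q
  ↑ʳ-∈-++⁻ y∈p++q = lookup⇒[]= _ q (trans (sym (lookup-++ʳ p q _)) ([]=⇒lookup y∈p++q))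

⁅x⁆++⁅x⁆-injective : ∀ {k} {x y : Fin k} {j} → j ∈ ⁅ x ⁆ ++ᵥ ⁅ x ⁆ → j ∈ ⁅ y ⁆ ++ᵥ ⁅ y ⁆ → x ≡ y
⁅x⁆++⁅x⁆-injective {k} {x} {y} {j} j∈x j∈y with splitAt k j in eq
... | inj₁ i with refl ← Fin.splitAt⁻¹-↑ˡ eq =
  trans (sym (x∈⁅y⁆⇒x≡y x (↑ˡ-∈-++⁻ j∈x))) (x∈⁅y⁆⇒x≡y y (↑ˡ-∈-++⁻ j∈y))
... | inj₂ i with refl ← Fin.splitAt⁻¹-↑ʳ eq =
  trans (sym (x∈⁅y⁆⇒x≡y x (↑ʳ-∈-++⁻ {p = ⁅ x ⁆} j∈x))) (x∈⁅y⁆⇒x≡y y (↑ʳ-∈-++⁻ {p = ⁅ y ⁆} j∈y))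

module _ {n m : ℕ} (H : Hypergraph n m) where

  Meets : Fin m → Fin m → Set
  Meets e f = Nonempty (edge H e ∩ edge H f)

  ProperOn : ∀ {p} {A : Set} → Pred (Fin m) p → (Fin m → A) → Set p
  ProperOn P c = ∀ e f → P e → P f → e ≢ f → c e ≡ c f → Disjoint H e f

  module _ {p q} {P : Pred (Fin m) p} {Q : Pred (Fin m) q} {A : Set} {c c′ : Fin m → A} where

    properOn-∪ : ProperOn P c → ProperOn Q c′ → (∀ {e} → P e → c′ e ≡ c e) →
                 (∀ {e f} → Q e → P f → Meets e f → c′ e ≢ c f) → ProperOn (P ∪ Q) c′
    properOn-∪ c-proper _ c′≡c _ e f (inj₁ Pe) (inj₁ Pf) e≢f eq =
      c-proper e f Pe Pf e≢f (trans (sym (c′≡c Pe)) (trans eq (c′≡c Pf)))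
    properOn-∪ _ c′-proper _ _ e f (inj₂ Qe) (inj₂ Qf) e≢f eq = c′-proper e f Qe Qf e≢f eq
    properOn-∪ _ _ c′≡c avoids e f (inj₂ Qe) (inj₁ Pf) _ eq w w∈e w∈f =
      avoids Qe Pf (w , x∈p∩q⁺ (w∈e , w∈f)) (trans eq (c′≡c Pf))
    properOn-∪ _ _ c′≡c avoids e f (inj₁ Pe) (inj₂ Qf) _ eq w w∈e w∈f =
      avoids Qf Pe (w , x∈p∩q⁺ (w∈f , w∈e)) (trans (sym eq) (c′≡c Pe))

  properOn-mono : ∀ {p q} {P : Pred (Fin m) p} {Q : Pred (Fin m) q} {A} {c : Fin m → A} →
                  (∀ {e} → Q e → P e) → ProperOn P c → ProperOn Q c
  properOn-mono Q⊆P c-proper e f Qe Qf = c-proper e f (Q⊆P Qe) (Q⊆P Qf)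

  properOn-rank≡1 : ∀ {A} {c : Fin m → A} → ProperOn (λ e → rank H e ≡ 1) c
  properOn-rank≡1 e f ∣e∣≡1 ∣f∣≡1 e≢f _ w w∈e w∈f =
    e≢f (edge-inj H (trans (∣p∣≡1⇒p≡⁅x⁆ ∣e∣≡1 w∈e) (sym (∣p∣≡1⇒p≡⁅x⁆ ∣f∣≡1 w∈f))))

  -- an edge of rank 0 is disjoint from every edge
  properOn-rank≥1⇒isEdgeColoring : ∀ {A} {c : Fin m → A} →
                                   ProperOn (λ e → 1 ≤ rank H e) c → IsEdgeColoring H c
  properOn-rank≥1⇒isEdgeColoring c-proper e f e≢f eq w w∈e w∈f =
    c-proper e f (x∈p⇒0<∣p∣ w∈e) (x∈p⇒0<∣p∣ w∈f) e≢f eq w w∈e w∈f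

  module _ {p} {P : Pred (Fin m) p} {A : Set} (c : Fin m → A) (P? : Decidable P) where

    meeting? : ∀ e → Decidable (λ f → P f × Meets e f)
    meeting? e f = P? f ×-dec nonempty? (edge H e ∩ edge H f)

    coloursMeeting : Fin m → List A
    coloursMeeting e = map c (filter (meeting? e) (allFin m))

    ∈-coloursMeeting : ∀ {e f} → P f → Meets e f → c f ∈ₗ coloursMeeting e
    ∈-coloursMeeting {f = f} Pf e-meets-f = ∈-map⁺ c (∈-filter⁺ (meeting? _) (∈-allFin f) (Pf , e-meets-f))

    length-coloursMeeting : ∀ {q r} {Q : Pred (Fin m) q} {R : Pred (Fin m) r}
                            (Q? : Decidable Q) (R? : Decidable R) {e} →
                            (∀ {f} → P f → Meets e f → Q f ⊎ R f) →
                            length (coloursMeeting e) ≤ count Q? (allFin m) + count R? (allFin m)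
    length-coloursMeeting Q? R? {e} split =
      ≤-trans (≤-reflexive (length-map c (filter (meeting? e) (allFin m))))
              (count-≤-+ (meeting? e) Q? R? (λ (Pf , e-meets-f) → split Pf e-meets-f) (allFin m))

  properOn-extend : ∀ {A} {c c′ : Fin m → A} k →
                    ProperOn (λ e → suc k ≤ rank H e) c → ProperOn (λ e → rank H e ≡ k) c′ →
                    (∀ {e} → rank H e ≢ k → c′ e ≡ c e) →
                    (∀ {e} → rank H e ≡ k → c′ e ∉ₗ coloursMeeting c (λ f → suc k ≤? rank H f) e) →
                    ProperOn (λ e → k ≤ rank H e) c′
  properOn-extend {c = c} {c′} k c-proper c′-proper c′≡c c′-avoids =
    properOn-mono k≤⇒ (properOn-∪ c-proper c′-proper (λ k<∣e∣ → c′≡c (<⇒≢ k<∣e∣ ∘ sym)) avoids)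
    where
    k≤⇒ : ∀ {e} → k ≤ rank H e → suc k ≤ rank H e ⊎ rank H e ≡ k
    k≤⇒ k≤∣e∣ = Sum.map₂ sym (m≤n⇒m<n∨m≡n k≤∣e∣)
    avoids : ∀ {e f} → rank H e ≡ k → suc k ≤ rank H f → Meets e f → c′ e ≢ c f
    avoids ∣e∣≡k k<∣f∣ e-meets-f eq =
      c′-avoids ∣e∣≡k (subst (_∈ₗ _) (sym eq)
                               (∈-coloursMeeting c (λ f → suc k ≤? rank H f) k<∣f∣ e-meets-f))

module PairGraph {n m : ℕ} (H : Hypergraph n m) where

  pairEdge : (e : Fin m) → Dec (rank H e ≡ 2) → Subset (n + (m + m))
  pairEdge e (yes _) = edge H e ++ᵥ ⊥
  pairEdge e (no _) = ⊥ {n} ++ᵥ (⁅ e ⁆ ++ᵥ ⁅ e ⁆)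

  pairEdge-injective : ∀ {e f} d₁ d₂ → pairEdge e d₁ ≡ pairEdge f d₂ → e ≡ f
  pairEdge-injective {e} {f} (yes _) (yes _) eq = edge-inj H (++-injectiveˡ (edge H e) (edge H f) eq)
  pairEdge-injective {e} {f} (no _) (no _) eq =
    x∈⁅y⁆⇒x≡y f (subst (e ∈_) (++-injectiveˡ ⁅ e ⁆ ⁅ f ⁆ (++-injectiveʳ (⊥ {n}) ⊥ eq)) (x∈⁅x⁆ e))
  pairEdge-injective {e} {f} (yes _) (no _) eq =
    contradiction (subst (f ↑ˡ m ∈_) (sym (++-injectiveʳ (edge H e) (⊥ {n}) eq))
                         (↑ˡ-∈-++⁺ {q = ⁅ f ⁆} (x∈⁅x⁆ f))) ∉⊥
  pairEdge-injective {e} {f} (no _) (yes _) eq =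
    contradiction (subst (e ↑ˡ m ∈_) (++-injectiveʳ (⊥ {n}) (edge H f) eq)
                         (↑ˡ-∈-++⁺ {q = ⁅ e ⁆} (x∈⁅x⁆ e))) ∉⊥

  pairGraph : Hypergraph (n + (m + m)) m
  edge pairGraph e = pairEdge e (rank H e ≟ 2)
  edge-inj pairGraph {e} {f} = pairEdge-injective (rank H e ≟ 2) (rank H f ≟ 2)

  pairGraph-simple : IsSimpleGraph pairGraph
  pairGraph-simple e = rank-pairEdge (rank H e ≟ 2)
    where
    open ≡-Reasoning
    rank-pairEdge : ∀ d → ∣ pairEdge e d ∣ ≡ 2
    rank-pairEdge (yes ∣e∣≡2) = begin
      ∣ edge H e ++ᵥ ⊥ ∣       ≡⟨ ∣p++q∣≡∣p∣+∣q∣ (edge H e) ⊥ ⟩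
      rank H e + ∣ ⊥ {m + m} ∣ ≡⟨ cong (rank H e +_) (∣⊥∣≡0 (m + m)) ⟩
      rank H e + 0             ≡⟨ +-identityʳ _ ⟩
      rank H e                 ≡⟨ ∣e∣≡2 ⟩
      2                        ∎
    rank-pairEdge (no _) = begin
      ∣ ⊥ {n} ++ᵥ (⁅ e ⁆ ++ᵥ ⁅ e ⁆) ∣       ≡⟨ ∣p++q∣≡∣p∣+∣q∣ (⊥ {n}) (⁅ e ⁆ ++ᵥ ⁅ e ⁆) ⟩
      ∣ ⊥ {n} ∣ + ∣ ⁅ e ⁆ ++ᵥ ⁅ e ⁆ ∣       ≡⟨ cong₂ _+_ (∣⊥∣≡0 n) (∣p++q∣≡∣p∣+∣q∣ ⁅ e ⁆ ⁅ e ⁆) ⟩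
      ∣ ⁅ e ⁆ ∣ + ∣ ⁅ e ⁆ ∣                 ≡⟨ cong₂ _+_ (∣⁅x⁆∣≡1 e) (∣⁅x⁆∣≡1 e) ⟩
      2                                     ∎

  ↑ˡ-∈-pairEdge⁺ : ∀ {e v} d → rank H e ≡ 2 → v ∈ edge H e → (v ↑ˡ (m + m)) ∈ pairEdge e d
  ↑ˡ-∈-pairEdge⁺ (yes _) _ v∈e = ↑ˡ-∈-++⁺ v∈e
  ↑ˡ-∈-pairEdge⁺ (no ∣e∣≢2) ∣e∣≡2 _ = contradiction ∣e∣≡2 ∣e∣≢2

  ↑ˡ-∈-pairEdge⁻ : ∀ {e v} d → (v ↑ˡ (m + m)) ∈ pairEdge e d → rank H e ≡ 2 × v ∈ edge H e
  ↑ˡ-∈-pairEdge⁻ (yes ∣e∣≡2) v∈e = ∣e∣≡2 , ↑ˡ-∈-++⁻ v∈e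
  ↑ˡ-∈-pairEdge⁻ {e} (no _) v∈⊥ = contradiction (↑ˡ-∈-++⁻ {q = ⁅ e ⁆ ++ᵥ ⁅ e ⁆} v∈⊥) ∉⊥

  ↑ʳ-∈-pairEdge⁻ : ∀ {e j} d → (n ↑ʳ j) ∈ pairEdge e d → j ∈ ⁅ e ⁆ ++ᵥ ⁅ e ⁆
  ↑ʳ-∈-pairEdge⁻ {e} (yes _) j∈⊥ = contradiction (↑ʳ-∈-++⁻ {p = edge H e} j∈⊥) ∉⊥
  ↑ʳ-∈-pairEdge⁻ (no _) j∈e = ↑ʳ-∈-++⁻ {p = ⊥ {n}} j∈e

  degree-pairGraph : ∀ w → degree pairGraph w ≤ maxDegree₂ H ⊔ 1
  degree-pairGraph w with splitAt n w in eq
  ... | inj₁ v with refl ← Fin.splitAt⁻¹-↑ˡ eq = begin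
    degree pairGraph (v ↑ˡ (m + m)) ≤⟨ count-mono _ (λ e → (rank H e ≟ 2) ×-dec (v ∈? edge H e))
                                                     (λ {e} → ↑ˡ-∈-pairEdge⁻ (rank H e ≟ 2)) (⊆-refl {x = allFin m}) ⟩
    degree₂ H v                     ≤⟨ ≤-maxOver H (degree₂ H) v ⟩
    maxDegree₂ H                    ≤⟨ m≤m⊔n _ 1 ⟩
    maxDegree₂ H ⊔ 1                ∎
    where open ≤-Reasoning
  ... | inj₂ j with refl ← Fin.splitAt⁻¹-↑ʳ eq = ≤-trans (count-≤-1 _ (Unique.allFin⁺ m) same-edge) (m≤n⊔m _ 1)
    where
    same-edge : ∀ {e f} → (n ↑ʳ j) ∈ edge pairGraph e → (n ↑ʳ j) ∈ edge pairGraph f → e ≡ f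
    same-edge {e} {f} j∈e j∈f =
      ⁅x⁆++⁅x⁆-injective (↑ʳ-∈-pairEdge⁻ (rank H e ≟ 2) j∈e) (↑ʳ-∈-pairEdge⁻ (rank H f ≟ 2) j∈f)

  maxDegree-pairGraph : maxDegree pairGraph ≤ maxDegree₂ H ⊔ 1
  maxDegree-pairGraph = maxOver-≤ pairGraph (degree pairGraph) degree-pairGraph


module Extension (hyp : ListColoringHypothesis) {n m : ℕ} (H : Hypergraph n m)
                 (bound : maxDegree₂ H + 2 * maxDegree₃ H + 1 ≤ n)
                 (c₃ : (e : Fin m) → 3 ≤ rank H e → Fin n) (c₃-proper : IsEdgeColoring₃ H c₃) where

  open PairGraph H

  Δ₂ Δ₃ : ℕ
  Δ₂ = maxDegree₂ H
  Δ₃ = maxDegree₃ H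

  rank≥2? : Decidable (λ f → 2 ≤ rank H f)
  rank≥2? f = 2 ≤? rank H f

  rank≥3? : Decidable (λ f → 3 ≤ rank H f)
  rank≥3? f = 3 ≤? rank H f

  rank≡2∋? : (v : Fin n) → Decidable (λ f → rank H f ≡ 2 × v ∈ edge H f)
  rank≡2∋? v f = (rank H f ≟ 2) ×-dec (v ∈? edge H f)
  rank≥3∋? : (v : Fin n) → Decidable (λ f → 3 ≤ rank H f × v ∈ edge H f)
  rank≥3∋? v f = (3 ≤? rank H f) ×-dec (v ∈? edge H f)

  colour₀ : Fin n
  colour₀ = fromℕ< (≤-trans (m≤n+m 1 _) bound)

  colour₃ : Fin m → Fin n
  colour₃ e with rank≥3? e
  ... | yes 3≤∣e∣ = c₃ e 3≤∣e∣
  ... | no _ = colour₀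

  colour₃-agrees : ∀ {e} (3≤∣e∣ : 3 ≤ rank H e) → colour₃ e ≡ c₃ e 3≤∣e∣
  colour₃-agrees {e} 3≤∣e∣ with rank≥3? e
  ... | yes 3≤∣e∣′ = cong (c₃ e) (≤-irrelevant 3≤∣e∣′ 3≤∣e∣)
  ... | no 3≰∣e∣ = contradiction 3≤∣e∣ 3≰∣e∣

  colour₃-proper : ProperOn H (λ e → 3 ≤ rank H e) colour₃
  colour₃-proper e f 3≤∣e∣ 3≤∣f∣ e≢f eq =
    c₃-proper e f 3≤∣e∣ 3≤∣f∣ e≢f
      (trans (sym (colour₃-agrees 3≤∣e∣)) (trans eq (colour₃-agrees 3≤∣f∣)))

  blocked₃ : Fin m → List (Fin n)
  blocked₃ = coloursMeeting H colour₃ rank≥3?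

  length-blocked₃ : ∀ {e} → rank H e ≡ 2 → length (blocked₃ e) ≤ 2 * Δ₃
  length-blocked₃ {e} ∣e∣≡2 with u , v , ⊆uv ← ∣p∣≡2⇒⊆pair ∣e∣≡2 = begin
    length (blocked₃ e)       ≤⟨ length-coloursMeeting H colour₃ rank≥3? (rank≥3∋? u) (rank≥3∋? v) at-u-or-v ⟩
    degree₃ H u + degree₃ H v ≤⟨ +-mono-≤ (≤-maxOver H (degree₃ H) u) (≤-maxOver H (degree₃ H) v) ⟩
    Δ₃ + Δ₃                   ≡⟨ cong (Δ₃ +_) (sym (+-identityʳ Δ₃)) ⟩
    2 * Δ₃                    ∎
    where
    open ≤-Reasoning
    at-u-or-v : ∀ {f} → 3 ≤ rank H f → Meets H e f →
                (3 ≤ rank H f × u ∈ edge H f) ⊎ (3 ≤ rank H f × v ∈ edge H f)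
    at-u-or-v {f} 3≤∣f∣ (w , w∈e∩f) with w∈e , w∈f ← x∈p∩q⁻ (edge H e) (edge H f) w∈e∩f | ⊆uv w∈e
    ... | inj₁ refl = inj₁ (3≤∣f∣ , w∈f)
    ... | inj₂ refl = inj₂ (3≤∣f∣ , w∈f)

  choosability : ∃[ q ] (q ≤ maxDegree pairGraph + 1 × EdgeChoosable pairGraph q)
  choosability = hyp _ _ pairGraph pairGraph-simple

  q : ℕ
  q = proj₁ choosability

  q≤Δ₂+1 : ∀ {e} → rank H e ≡ 2 → q ≤ Δ₂ + 1
  q≤Δ₂+1 {e} ∣e∣≡2 with u , u∈e ← ∣p∣≡suc⇒nonempty ∣e∣≡2 = begin
    q                         ≤⟨ proj₁ (proj₂ choosability) ⟩
    maxDegree pairGraph + 1   ≤⟨ +-monoˡ-≤ 1 maxDegree-pairGraph ⟩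
    Δ₂ ⊔ 1 + 1                ≡⟨ cong (_+ 1) (m≥n⇒m⊔n≡m 1≤Δ₂) ⟩
    Δ₂ + 1                    ∎
    where
    open ≤-Reasoning
    1≤Δ₂ : 1 ≤ Δ₂
    1≤Δ₂ = ≤-trans (filter-some (rank≡2∋? u) (lose (∈-allFin e) (∣e∣≡2 , u∈e)))
                   (≤-maxOver H (degree₂ H) u)

  palette : Fin m → List (Fin n)
  palette e = take q (available (blocked₃ e))

  length-palette : ∀ {e} → rank H e ≡ 2 → length (palette e) ≡ q
  length-palette {e} ∣e∣≡2 =
    trans (length-take q _) (m≤n⇒m⊓n≡m (length-available (blocked₃ e) q+blocked≤n))
    where
    open ≤-Reasoning
    q+blocked≤n : q + length (blocked₃ e) ≤ n
    q+blocked≤n = begin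
      q + length (blocked₃ e) ≤⟨ +-mono-≤ (q≤Δ₂+1 ∣e∣≡2) (length-blocked₃ ∣e∣≡2) ⟩
      Δ₂ + 1 + 2 * Δ₃         ≡⟨ +-assoc Δ₂ 1 (2 * Δ₃) ⟩
      Δ₂ + (1 + 2 * Δ₃)       ≡⟨ cong (Δ₂ +_) (+-comm 1 (2 * Δ₃)) ⟩
      Δ₂ + (2 * Δ₃ + 1)       ≡⟨ +-assoc Δ₂ (2 * Δ₃) 1 ⟨
      Δ₂ + 2 * Δ₃ + 1         ≤⟨ bound ⟩
      n                       ∎

  listFor : (e : Fin m) → Dec (rank H e ≡ 2) → List ℕ
  listFor e (yes _) = map toℕ (palette e)
  listFor e (no _) = upTo q

  length-listFor : ∀ e d → length (listFor e d) ≡ q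
  length-listFor e (yes ∣e∣≡2) = trans (length-map toℕ (palette e)) (length-palette ∣e∣≡2)
  length-listFor e (no _) = length-upTo q

  listFor-unique : ∀ e d → Unique (listFor e d)
  listFor-unique e (yes _) =
    Unique.map⁺ Fin.toℕ-injective (Unique.take⁺ q (available-unique (blocked₃ e)))
  listFor-unique e (no _) = Unique.upTo⁺ q

  listColouring : Σ[ c ∈ (Fin m → ℕ) ]
                    ((∀ e → c e ∈ₗ listFor e (rank H e ≟ 2)) × IsEdgeColoring pairGraph c)
  listColouring = proj₂ (proj₂ choosability) (λ e → listFor e (rank H e ≟ 2))
                    (λ e → length-listFor e (rank H e ≟ 2)) (λ e → listFor-unique e (rank H e ≟ 2))

  listColour : Fin m → ℕ
  listColour = proj₁ listColouring

  colour₂ : Fin m → Fin n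
  colour₂ e with rank H e ≟ 2 | proj₁ (proj₂ listColouring) e
  ... | yes _ | c∈list = proj₁ (∈-map⁻ toℕ c∈list)
  ... | no _ | _ = colour₃ e

  colour₂-chosen : ∀ {e} → rank H e ≡ 2 → colour₂ e ∈ₗ palette e × listColour e ≡ toℕ (colour₂ e)
  colour₂-chosen {e} ∣e∣≡2 with rank H e ≟ 2 | proj₁ (proj₂ listColouring) e
  ... | yes _ | c∈list = proj₂ (∈-map⁻ toℕ c∈list)
  ... | no ∣e∣≢2 | _ = contradiction ∣e∣≡2 ∣e∣≢2

  colour₂-unchanged : ∀ {e} → rank H e ≢ 2 → colour₂ e ≡ colour₃ e
  colour₂-unchanged {e} ∣e∣≢2 with rank H e ≟ 2 | proj₁ (proj₂ listColouring) e
  ... | yes ∣e∣≡2 | _ = contradiction ∣e∣≡2 ∣e∣≢2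
  ... | no _ | _ = refl

  colour₂-avoids : ∀ {e} → rank H e ≡ 2 → colour₂ e ∉ₗ blocked₃ e
  colour₂-avoids ∣e∣≡2 =
    All.lookup (All-take⁺ q (All.tabulate available-∉)) (proj₁ (colour₂-chosen ∣e∣≡2))

  colour₂-proper-on-rank≡2 : ProperOn H (λ e → rank H e ≡ 2) colour₂
  colour₂-proper-on-rank≡2 e f ∣e∣≡2 ∣f∣≡2 e≢f eq w w∈e w∈f =
    proj₂ (proj₂ listColouring) e f e≢f same-list-colour (w ↑ˡ (m + m))
      (↑ˡ-∈-pairEdge⁺ (rank H e ≟ 2) ∣e∣≡2 w∈e) (↑ˡ-∈-pairEdge⁺ (rank H f ≟ 2) ∣f∣≡2 w∈f)
    where
    same-list-colour : listColour e ≡ listColour f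
    same-list-colour = begin
      listColour e    ≡⟨ proj₂ (colour₂-chosen ∣e∣≡2) ⟩
      toℕ (colour₂ e) ≡⟨ cong toℕ eq ⟩
      toℕ (colour₂ f) ≡⟨ proj₂ (colour₂-chosen ∣f∣≡2) ⟨
      listColour f    ∎
      where open ≡-Reasoning

  colour₂-proper : ProperOn H (λ e → 2 ≤ rank H e) colour₂
  colour₂-proper =
    properOn-extend H 2 colour₃-proper colour₂-proper-on-rank≡2 colour₂-unchanged colour₂-avoids

  blocked₂ : Fin m → List (Fin n)
  blocked₂ = coloursMeeting H colour₂ rank≥2?

  length-blocked₂ : ∀ {e} → rank H e ≡ 1 → length (blocked₂ e) < n
  length-blocked₂ {e} ∣e∣≡1 with w , w∈e ← ∣p∣≡suc⇒nonempty ∣e∣≡1 = begin-strict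
    length (blocked₂ e)       ≤⟨ length-coloursMeeting H colour₂ rank≥2? (rank≡2∋? w) (rank≥3∋? w) at-w ⟩
    degree₂ H w + degree₃ H w ≤⟨ +-mono-≤ (≤-maxOver H (degree₂ H) w) (≤-maxOver H (degree₃ H) w) ⟩
    Δ₂ + Δ₃                   ≤⟨ +-monoʳ-≤ Δ₂ (m≤m+n Δ₃ (Δ₃ + 0)) ⟩
    Δ₂ + 2 * Δ₃               <⟨ ≤-trans (≤-reflexive (+-comm 1 (Δ₂ + 2 * Δ₃))) bound ⟩
    n                         ∎
    where
    open ≤-Reasoning
    at-w : ∀ {f} → 2 ≤ rank H f → Meets H e f →
           (rank H f ≡ 2 × w ∈ edge H f) ⊎ (3 ≤ rank H f × w ∈ edge H f)
    at-w {f} 2≤∣f∣ (x , x∈e∩f) with x∈e , x∈f ← x∈p∩q⁻ (edge H e) (edge H f) x∈e∩f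
      with refl ← x∈⁅y⁆⇒x≡y w (subst (x ∈_) (∣p∣≡1⇒p≡⁅x⁆ ∣e∣≡1 w∈e) x∈e) =
      Sum.map (_, x∈f) (_, x∈f) (Sum.swap (Sum.map₂ sym (m≤n⇒m<n∨m≡n 2≤∣f∣)))

  colour₁ : Fin m → Fin n
  colour₁ e with rank H e ≟ 1
  ... | yes ∣e∣≡1 = proj₁ (fresh (blocked₂ e) (length-blocked₂ ∣e∣≡1))
  ... | no _ = colour₂ e

  colour₁-avoids : ∀ {e} → rank H e ≡ 1 → colour₁ e ∉ₗ blocked₂ e
  colour₁-avoids {e} ∣e∣≡1 with rank H e ≟ 1
  ... | yes ∣e∣≡1′ = proj₂ (fresh (blocked₂ e) (length-blocked₂ ∣e∣≡1′))
  ... | no ∣e∣≢1 = contradiction ∣e∣≡1 ∣e∣≢1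

  colour₁-unchanged : ∀ {e} → rank H e ≢ 1 → colour₁ e ≡ colour₂ e
  colour₁-unchanged {e} ∣e∣≢1 with rank H e ≟ 1
  ... | yes ∣e∣≡1 = contradiction ∣e∣≡1 ∣e∣≢1
  ... | no _ = refl

  colour₁-proper : ProperOn H (λ e → 1 ≤ rank H e) colour₁
  colour₁-proper =
    properOn-extend H 1 colour₂-proper (properOn-rank≡1 H) colour₁-unchanged colour₁-avoids

  colour₁-extends : ∀ e (3≤∣e∣ : 3 ≤ rank H e) → colour₁ e ≡ c₃ e 3≤∣e∣
  colour₁-extends e 3≤∣e∣ = begin
    colour₁ e    ≡⟨ colour₁-unchanged (<⇒≢ (<-trans (s≤s (s≤s z≤n)) 3≤∣e∣) ∘ sym) ⟩
    colour₂ e    ≡⟨ colour₂-unchanged (<⇒≢ 3≤∣e∣ ∘ sym) ⟩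
    colour₃ e    ≡⟨ colour₃-agrees 3≤∣e∣ ⟩
    c₃ e 3≤∣e∣  ∎
    where open ≡-Reasoning

theorem8 : ListColoringHypothesis →
    (n m : ℕ) (H : Hypergraph n m) → Linear H →
    maxDegree₂ H + 2 * maxDegree₃ H + 1 ≤ n →
    (c₃ : (e : Fin m) → 3 ≤ rank H e → Fin n) → IsEdgeColoring₃ H c₃ →
    Σ[ c ∈ (Fin m → Fin n) ] (IsEdgeColoring H c × (∀ e (p : 3 ≤ rank H e) → c e ≡ c₃ e p))
theorem8 hyp n m H _ bound c₃ c₃-proper =
  colour₁ , properOn-rank≥1⇒isEdgeColoring H colour₁-proper , colour₁-extends
  where open Extension hyp H bound c₃ c₃-proper
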